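{- For a positive integer $n$, let $\mathcal{Q}(n)$ be the set of linear collections of subsets of $[n]=\{1,\dots,n\}$ and $\mathcal{Q}_s(n)$ the set of scarce linear collections of subsets of $[n]$. Then $|\mathcal{Q}(n)|\le |\mathcal{Q}_s(n)|\cdot 2^{2\sum_{k=0}^{\lfloor n/3\rfloor}\binom{n}{k}}$.
   Context: A collection of sets $\mathcal{B}\neq\{\emptyset\}$ is linear if there do not exist disjoint sets $X,Y$ with $|\{X,Y,X\cup Y\}\cap\mathcal{B}|=2$. A linear collection $\mathcal{B}$ is scarce if $|\{X,Y,X\cup Y\}\cap\mathcal{B}|\le 1$ for all disjoint sets $X,Y$. The paper writes $\binom{n}{\le n/3}$ for $\sum_{k=0}^{\lfloor n/3\rfloor}\binom{n}{k}$. -}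

module Defs where

open import Data.Bool using (Bool; true; false; _∧_; _∨_; not; _xor_)
open import Data.Nat using (ℕ; zero; suc; _+_; _*_; _^_; _/_; _≡ᵇ_; _≤ᵇ_)
open import Data.Nat.Combinatorics using (_C_)
open import Data.Fin using (Fin; _↑ˡ_; _↑ʳ_)
open import Data.Fin.Subset using (Subset; _∩_; _∪_; ⊥)
open import Data.Vec using (Vec; []; _∷_; lookup)
open import Data.List using (List; []; _∷_; _++_; map; filterᵇ; length; upTo)
open import Data.Bool.ListAction using (all)
open import Data.Nat.ListAction using (sum)

-- Subsets of [n] are represented by Data.Fin.Subset n (characteristic vectors).
-- A collection of subsets of [n] is its membership predicate.
Collection : ℕ → Set
Collection n = Subset n → Bool

_==_ : ∀ {n} → Subset n → Subset n → Bool
[] == [] = true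
(a ∷ s) == (b ∷ t) = not (a xor b) ∧ (s == t)

allSubsets : (n : ℕ) → List (Subset n)
allSubsets zero = [] ∷ []
allSubsets (suc n) = map (false ∷_) (allSubsets n) ++ map (true ∷_) (allSubsets n)

index : ∀ {n} → Subset n → Fin (2 ^ n)
index [] = Fin.zero
index {suc n} (false ∷ s) = index s ↑ˡ (2 ^ n + 0)
index {suc n} (true ∷ s) = (2 ^ n) ↑ʳ (index s ↑ˡ 0)

-- enumeration of all collections of subsets of [n], each exactly once
-- (a collection is determined by its characteristic vector of length 2^n)
allCollections : (n : ℕ) → List (Collection n)
allCollections n = map (λ v S → lookup v (index S)) (allSubsets (2 ^ n))

dedup : ∀ {n} → List (Subset n) → List (Subset n)
dedup [] = []
dedup (x ∷ xs) = x ∷ filterᵇ (λ y → not (x == y)) (dedup xs)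

disjoint : ∀ {n} → Subset n → Subset n → Bool
disjoint X Y = (X ∩ Y) == ⊥

-- |{X, Y, X ∪ Y} ∩ B|  (cardinality of the set, duplicates counted once)
hits : ∀ {n} → Collection n → Subset n → Subset n → ℕ
hits B X Y = length (filterᵇ B (dedup (X ∷ Y ∷ (X ∪ Y) ∷ [])))

isSingletonEmpty : ∀ {n} → Collection n → Bool
isSingletonEmpty {n} B = all (λ S → not (B S xor (S == ⊥))) (allSubsets n)

isLinear : ∀ {n} → Collection n → Bool
isLinear {n} B =
  not (isSingletonEmpty B) ∧
  all (λ X → all (λ Y → not (disjoint X Y) ∨ not (hits B X Y ≡ᵇ 2)) (allSubsets n)) (allSubsets n)

isScarce : ∀ {n} → Collection n → Bool
isScarce {n} B =
  isLinear B ∧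
  all (λ X → all (λ Y → not (disjoint X Y) ∨ (hits B X Y ≤ᵇ 1)) (allSubsets n)) (allSubsets n)

numLinear : ℕ → ℕ
numLinear n = length (filterᵇ isLinear (allCollections n))

numScarce : ℕ → ℕ
numScarce n = length (filterᵇ isScarce (allCollections n))

binomLeThird : ℕ → ℕ
binomLeThird n = sum (map (λ k → n C k) (upTo (suc (n / 3))))

open import Relation.Binary.PropositionalEquality using (_≡_; refl)
private
  t1 : numLinear 1 ≡ 2
  t1 = refl
  t2 : binomLeThird 3 ≡ 4
  t2 = refl
  t3 : numScarce 1 ≡ 2
  t3 = refl

{-# OPTIONS --safe #-}
module Submission where

-- A linear collection B is recorded by three pieces of data: its core, made of the members S of B
-- with more than n/3 elements that neither split as S = Y ∪ Z with Y ∈ B and Y, Z disjoint and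
-- nonempty, nor are disjoint from a member of B with more than n/3 elements and smaller binary rank;
-- and the restrictions of B to the sets with at most n/3 elements and to their complements. The
-- core is scarce by construction. The data determine B, by induction on rank: a large S ∈ B outside
-- the core either splits, and then Z ∈ B by linearity, so S = Y ∪ Z is recovered from smaller
-- members; or it is disjoint from a large Y ∈ B of smaller rank, and then S ∪ Y ∈ B has at most
-- n/3 elements outside it, so S is recovered from Y and S ∪ Y.

open import Defs
open import Data.Bool using (Bool; true; false; T; not; _∨_; _xor_)
open import Data.Bool.ListAction using (all)
open import Data.Bool.Properties using (T?; T-∧)
import Data.Bool.Properties as Bool
open import Data.Empty using (⊥-elim)
open import Data.Fin using (Fin; toℕ; splitAt; _↑ˡ_; _↑ʳ_)
open import Data.Fin.Properties
  using (toℕ-↑ˡ; toℕ-↑ʳ; toℕ-injective; splitAt-↑ˡ; splitAt-↑ʳ; splitAt⁻¹-↑ˡ; splitAt⁻¹-↑ʳ)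
open import Data.Fin.Subset using (Subset; ⊥; _∪_; ∁; ∣_∣)
open import Data.Fin.Subset.Properties using (∪-comm; ∪-identityʳ; ∣⊥∣≡0; ∣∁p∣≡n∸∣p∣; anySubset?)
open import Data.List using (List; []; _∷_; _++_; map; length; filterᵇ; cartesianProduct; concatMap; upTo)
open import Data.List.Membership.Propositional using (_∈_)
open import Data.List.Membership.Propositional.Properties
  using (∈-map⁺; ∈-map⁻; ∈-++⁺ˡ; ∈-++⁺ʳ; ∈-concat⁺′; ∈-upTo⁺; ∈-cartesianProduct⁺; ∈-filter⁺; ∈-filter⁻)
open import Data.List.Properties
  using (length-++; length-map; length-removeAt′; map-cong; filter-accept; filter-reject; filter-all; filter-≐)
import Data.List.Properties as List
open import Data.List.Relation.Binary.Disjoint.Propositional using (Disjoint)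
open import Data.List.Relation.Unary.All as All using ([]; _∷_)
open import Data.List.Relation.Unary.All.Properties using (all⁺; all⁻)
open import Data.List.Relation.Unary.AllPairs using ([]; _∷_)
open import Data.List.Relation.Unary.Any as Any using (here; there)
open import Data.List.Relation.Unary.Unique.Propositional using (Unique)
import Data.List.Relation.Unary.Unique.Propositional.Properties as Unique
open import Data.Nat using (ℕ; zero; suc; _+_; _*_; _^_; _∸_; _/_; _%_; _≤_; _<_; z≤n; s≤s; _≡ᵇ_)
open import Data.Nat.Combinatorics using (_C_; nCk+nC[k+1]≡[n+1]C[k+1])
open import Data.Nat.DivMod using (m≡m%n+[m/n]*n; m%n<n)
open import Data.Nat.Induction using (<-wellFounded)
open import Data.Nat.ListAction using (sum)
open import Data.Nat.Properties
open import Algebra.Properties.CommutativeSemigroup +-commutativeSemigroup using (x∙yz≈y∙xz)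
open import Data.Nat.Tactic.RingSolver using (solve-∀)
open import Data.Product using (∃-syntax; _×_; _,_; proj₁; proj₂)
open import Data.Sum using (inj₁; inj₂)
open import Data.Vec using (Vec; []; _∷_; lookup; tabulate; toList; fromList)
open import Data.Vec.Properties
  using (≡-dec; ∷-injectiveʳ; lookup∘tabulate; tabulate∘lookup; tabulate-cong; toList∘fromList)
open import Function using (_∘_; _on_)
open import Function.Bundles using (Equivalence)
open import Induction.WellFounded using (Acc; acc)
open import Relation.Binary.Definitions using (DecidableEquality; tri<; tri≈; tri>)
import Relation.Binary.Construct.On as On
open import Relation.Binary.PropositionalEquality
open import Relation.Nullary using (¬_; yes; no)
open import Relation.Nullary.Decidable using (decidable-stable; ⌊_⌋; toWitness; fromWitness; _×-dec_; ¬?)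
open import Relation.Unary using (Decidable)

module _ {A B : Set} where

  filterᵇ-map : ∀ (p : B → Bool) (f : A → B) xs → filterᵇ p (map f xs) ≡ map f (filterᵇ (p ∘ f) xs)
  filterᵇ-map p f [] = refl
  filterᵇ-map p f (x ∷ xs) with p (f x)
  ... | true = cong (f x ∷_) (filterᵇ-map p f xs)
  ... | false = filterᵇ-map p f xs

  map-≡⇒≗-on : ∀ {f g : A → B} (xs : List A) → map f xs ≡ map g xs → ∀ {x} → x ∈ xs → f x ≡ g x
  map-≡⇒≗-on (_ ∷ _) eq (here refl) = List.∷-injectiveˡ eq
  map-≡⇒≗-on (_ ∷ xs) eq (there x∈xs) = map-≡⇒≗-on xs (List.∷-injectiveʳ eq) x∈xs

  length-concatMap : ∀ (f : A → List B) xs → length (concatMap f xs) ≡ sum (map (length ∘ f) xs)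
  length-concatMap f [] = refl
  length-concatMap f (x ∷ xs) = trans (length-++ (f x)) (cong (length (f x) +_) (length-concatMap f xs))

  length-cartesianProduct : ∀ (xs : List A) (ys : List B) →
    length (cartesianProduct xs ys) ≡ length xs * length ys
  length-cartesianProduct [] ys = refl
  length-cartesianProduct (x ∷ xs) ys = begin
    length (map (x ,_) ys ++ cartesianProduct xs ys)          ≡⟨ length-++ (map (x ,_) ys) ⟩
    length (map (x ,_) ys) + length (cartesianProduct xs ys)  ≡⟨ cong₂ _+_ (length-map (x ,_) ys)
                                                                   (length-cartesianProduct xs ys) ⟩
    length ys + length xs * length ys                          ∎
    where open ≡-Reasoning

module _ {A : Set} where

  Unique⇒length≤1 : ∀ {xs : List A} → Unique xs → (∀ {x y} → x ∈ xs → y ∈ xs → x ≡ y) → length xs ≤ 1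
  Unique⇒length≤1 {[]} _ _ = z≤n
  Unique⇒length≤1 {_ ∷ []} _ _ = s≤s z≤n
  Unique⇒length≤1 {_ ∷ _ ∷ _} ((x≢y ∷ _) ∷ _) all-equal =
    ⊥-elim (x≢y (all-equal (here refl) (there (here refl))))

  ∈-─ : ∀ {x y} {ys : List A} (x∈ys : x ∈ ys) → y ∈ ys → y ≢ x → y ∈ (ys Any.─ x∈ys)
  ∈-─ (here refl) (here refl) y≢x = ⊥-elim (y≢x refl)
  ∈-─ (here refl) (there y∈ys) _ = y∈ys
  ∈-─ (there x∈ys) (here refl) _ = here refl
  ∈-─ (there x∈ys) (there y∈ys) y≢x = there (∈-─ x∈ys y∈ys y≢x)

module _ {A B : Set} (f : A → B) where

  length-≤-injectiveOn : ∀ {xs : List A} {ys : List B} → Unique xs →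
    (∀ {x} → x ∈ xs → f x ∈ ys) →
    (∀ {x y} → x ∈ xs → y ∈ xs → f x ≡ f y → x ≡ y) →
    length xs ≤ length ys
  length-≤-injectiveOn {[]} _ _ _ = z≤n
  length-≤-injectiveOn {x ∷ xs} {ys} (x≢xs ∷ unique) maps-into injective = begin
    suc (length xs)                ≤⟨ s≤s (length-≤-injectiveOn unique maps-into′ injective′) ⟩
    suc (length (ys Any.─ fx∈ys))  ≡⟨ length-removeAt′ ys (Any.index fx∈ys) ⟨
    length ys                      ∎
    where
    open ≤-Reasoning
    fx∈ys : f x ∈ ys
    fx∈ys = maps-into (here refl)
    injective′ : ∀ {y z} → y ∈ xs → z ∈ xs → f y ≡ f z → y ≡ z
    injective′ y∈xs z∈xs = injective (there y∈xs) (there z∈xs)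
    maps-into′ : ∀ {y} → y ∈ xs → f y ∈ (ys Any.─ fx∈ys)
    maps-into′ y∈xs = ∈-─ fx∈ys (maps-into (there y∈xs))
      (λ fy≡fx → All.lookup x≢xs y∈xs (sym (injective (there y∈xs) (here refl) fy≡fx)))

T-not⇒¬T : ∀ {b} → T (not b) → ¬ T b
T-not⇒¬T {true} ()

¬T⇒T-not : ∀ {b} → ¬ T b → T (not b)
¬T⇒T-not {true} ¬b = ¬b _
¬T⇒T-not {false} _ = _

T-⇔⇒≡ : ∀ {a b} → (T a → T b) → (T b → T a) → a ≡ b
T-⇔⇒≡ {true} {true} _ _ = refl
T-⇔⇒≡ {true} {false} a⇒b _ = ⊥-elim (a⇒b _)
T-⇔⇒≡ {false} {true} _ b⇒a = ⊥-elim (b⇒a _)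
T-⇔⇒≡ {false} {false} _ _ = refl

T-not-∨-intro : ∀ {a b} → (T a → T b) → T (not a ∨ b)
T-not-∨-intro {true} a⇒b = a⇒b _
T-not-∨-intro {false} _ = _

T-not-∨-elim : ∀ {a b} → T (not a ∨ b) → T a → T b
T-not-∨-elim {true} b _ = b

T-not-xor-elim : ∀ {a b} → T (not (a xor b)) → T b → T a
T-not-xor-elim {true} _ _ = _
T-not-xor-elim {false} {false} _ ()

module _ {n : ℕ} where

  _≠ᵇ_ : Subset n → Subset n → Bool
  s ≠ᵇ t = not (s == t)

  Small Large : Subset n → Set
  Small S = ∣ S ∣ ≤ n / 3
  Large S = n / 3 < ∣ S ∣

==⇒≡ : ∀ {n} {s t : Subset n} → T (s == t) → s ≡ t
==⇒≡ {s = []} {[]} _ = refl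
==⇒≡ {s = true ∷ s} {true ∷ t} eq = cong (true ∷_) (==⇒≡ eq)
==⇒≡ {s = false ∷ s} {false ∷ t} eq = cong (false ∷_) (==⇒≡ eq)

==-refl : ∀ {n} (s : Subset n) → T (s == s)
==-refl [] = _
==-refl (true ∷ s) = ==-refl s
==-refl (false ∷ s) = ==-refl s

≢⇒≠ᵇ : ∀ {n} {s t : Subset n} → s ≢ t → T (s ≠ᵇ t)
≢⇒≠ᵇ s≢t = ¬T⇒T-not (s≢t ∘ ==⇒≡)

≠ᵇ⇒≢ : ∀ {n} {s t : Subset n} → T (s ≠ᵇ t) → s ≢ t
≠ᵇ⇒≢ {s = s} s≠s refl = T-not⇒¬T s≠s (==-refl s)

disjoint-sym : ∀ {n} (X Y : Subset n) → T (disjoint X Y) → T (disjoint Y X)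
disjoint-sym [] [] _ = _
disjoint-sym (false ∷ X) (false ∷ Y) d = disjoint-sym X Y d
disjoint-sym (false ∷ X) (true ∷ Y) d = disjoint-sym X Y d
disjoint-sym (true ∷ X) (false ∷ Y) d = disjoint-sym X Y d

disjoint-self⇒⊥ : ∀ {n} (X : Subset n) → T (disjoint X X) → X ≡ ⊥
disjoint-self⇒⊥ [] _ = refl
disjoint-self⇒⊥ (false ∷ X) d = cong (false ∷_) (disjoint-self⇒⊥ X d)

∣p∪q∣≡∣p∣+∣q∣ : ∀ {n} (X Y : Subset n) → T (disjoint X Y) → ∣ X ∪ Y ∣ ≡ ∣ X ∣ + ∣ Y ∣
∣p∪q∣≡∣p∣+∣q∣ [] [] _ = refl
∣p∪q∣≡∣p∣+∣q∣ (false ∷ X) (false ∷ Y) d = ∣p∪q∣≡∣p∣+∣q∣ X Y d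
∣p∪q∣≡∣p∣+∣q∣ (true ∷ X) (false ∷ Y) d = cong suc (∣p∪q∣≡∣p∣+∣q∣ X Y d)
∣p∪q∣≡∣p∣+∣q∣ (false ∷ X) (true ∷ Y) d = trans (cong suc (∣p∪q∣≡∣p∣+∣q∣ X Y d)) (sym (+-suc ∣ X ∣ ∣ Y ∣))

∁-involutive : ∀ {n} (S : Subset n) → ∁ (∁ S) ≡ S
∁-involutive [] = refl
∁-involutive (false ∷ S) = cong (false ∷_) (∁-involutive S)
∁-involutive (true ∷ S) = cong (true ∷_) (∁-involutive S)

large⇒≢⊥ : ∀ {n} {S : Subset n} → Large S → S ≢ ⊥
large⇒≢⊥ {n} large refl = n≮0 (subst (n / 3 <_) (∣⊥∣≡0 n) large)

n≤[1+n/3]+[1+n/3]+n/3 : ∀ n → n ≤ suc (n / 3) + suc (n / 3) + n / 3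
n≤[1+n/3]+[1+n/3]+n/3 n = begin
  n                                  ≡⟨ m≡m%n+[m/n]*n n 3 ⟩
  n % 3 + n / 3 * 3                  ≤⟨ +-monoˡ-≤ (n / 3 * 3) (≤-pred (m%n<n n 3)) ⟩
  2 + n / 3 * 3                      ≡⟨ 2+k*3≡[1+k]+[1+k]+k (n / 3) ⟩
  suc (n / 3) + suc (n / 3) + n / 3  ∎
  where
  open ≤-Reasoning
  2+k*3≡[1+k]+[1+k]+k : ∀ k → 2 + k * 3 ≡ suc k + suc k + k
  2+k*3≡[1+k]+[1+k]+k = solve-∀

large-∪-cosmall : ∀ {n} (S Y : Subset n) → T (disjoint S Y) → Large S → Large Y → Small (∁ (S ∪ Y))
large-∪-cosmall {n} S Y d largeS largeY = begin
  ∣ ∁ (S ∪ Y) ∣  ≡⟨ ∣∁p∣≡n∸∣p∣ (S ∪ Y) ⟩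
  n ∸ ∣ S ∪ Y ∣  ≤⟨ m≤n+o⇒m∸n≤o n ∣ S ∪ Y ∣ n≤∣S∪Y∣+k ⟩
  k              ∎
  where
  open ≤-Reasoning
  k = n / 3
  n≤∣S∪Y∣+k : n ≤ ∣ S ∪ Y ∣ + k
  n≤∣S∪Y∣+k = begin
    n                      ≤⟨ n≤[1+n/3]+[1+n/3]+n/3 n ⟩
    suc k + suc k + k      ≤⟨ +-monoˡ-≤ k (+-mono-≤ largeS largeY) ⟩
    ∣ S ∣ + ∣ Y ∣ + k      ≡⟨ cong (_+ k) (∣p∪q∣≡∣p∣+∣q∣ S Y d) ⟨
    ∣ S ∪ Y ∣ + k          ∎

allSubsets-complete : ∀ {n} (S : Subset n) → S ∈ allSubsets n
allSubsets-complete [] = here refl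
allSubsets-complete (false ∷ S) = ∈-++⁺ˡ (∈-map⁺ (false ∷_) (allSubsets-complete S))
allSubsets-complete {suc n} (true ∷ S) =
  ∈-++⁺ʳ (map (false ∷_) (allSubsets n)) (∈-map⁺ (true ∷_) (allSubsets-complete S))

allSubsets-unique : ∀ n → Unique (allSubsets n)
allSubsets-unique zero = [] ∷ []
allSubsets-unique (suc n) = Unique.++⁺
  (Unique.map⁺ ∷-injectiveʳ (allSubsets-unique n))
  (Unique.map⁺ ∷-injectiveʳ (allSubsets-unique n))
  heads-differ
  where
  heads-differ : Disjoint (map (false ∷_) (allSubsets n)) (map (true ∷_) (allSubsets n))
  heads-differ (S∈₀ , S∈₁) with ∈-map⁻ (false ∷_) S∈₀ | ∈-map⁻ (true ∷_) S∈₁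
  ... | _ , _ , refl | _ , _ , ()

length-allSubsets : ∀ n → length (allSubsets n) ≡ 2 ^ n
length-allSubsets zero = refl
length-allSubsets (suc n) = begin
  length (map (false ∷_) (allSubsets n) ++ map (true ∷_) (allSubsets n))
    ≡⟨ length-++ (map (false ∷_) (allSubsets n)) ⟩
  length (map (false ∷_) (allSubsets n)) + length (map (true ∷_) (allSubsets n))
    ≡⟨ cong₂ _+_ (length-map (false ∷_) (allSubsets n)) (length-map (true ∷_) (allSubsets n)) ⟩
  length (allSubsets n) + length (allSubsets n)
    ≡⟨ cong (λ m → m + m) (length-allSubsets n) ⟩
  2 ^ n + 2 ^ n
    ≡⟨ cong (2 ^ n +_) (+-identityʳ (2 ^ n)) ⟨
  2 ^ n + (2 ^ n + 0)  ∎
  where open ≡-Reasoning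

subsetsOfSize : ∀ n → ℕ → List (Subset n)
subsetsOfSize zero zero = [] ∷ []
subsetsOfSize zero (suc j) = []
subsetsOfSize (suc n) zero = map (false ∷_) (subsetsOfSize n zero)
subsetsOfSize (suc n) (suc j) = map (false ∷_) (subsetsOfSize n (suc j)) ++ map (true ∷_) (subsetsOfSize n j)

length-subsetsOfSize : ∀ n j → length (subsetsOfSize n j) ≡ n C j
length-subsetsOfSize zero zero = refl
length-subsetsOfSize zero (suc j) = refl
length-subsetsOfSize (suc n) zero =
  trans (length-map (false ∷_) (subsetsOfSize n zero)) (length-subsetsOfSize n zero)
length-subsetsOfSize (suc n) (suc j) = begin
  length (map (false ∷_) (subsetsOfSize n (suc j)) ++ map (true ∷_) (subsetsOfSize n j))
    ≡⟨ length-++ (map (false ∷_) (subsetsOfSize n (suc j))) ⟩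
  length (map (false ∷_) (subsetsOfSize n (suc j))) + length (map (true ∷_) (subsetsOfSize n j))
    ≡⟨ cong₂ _+_ (length-map (false ∷_) (subsetsOfSize n (suc j))) (length-map (true ∷_) (subsetsOfSize n j)) ⟩
  length (subsetsOfSize n (suc j)) + length (subsetsOfSize n j)
    ≡⟨ cong₂ _+_ (length-subsetsOfSize n (suc j)) (length-subsetsOfSize n j) ⟩
  n C suc j + n C j
    ≡⟨ +-comm (n C suc j) (n C j) ⟩
  n C j + n C suc j
    ≡⟨ nCk+nC[k+1]≡[n+1]C[k+1] n j ⟩
  suc n C suc j  ∎
  where open ≡-Reasoning

∈-subsetsOfSize : ∀ {n} (S : Subset n) → S ∈ subsetsOfSize n ∣ S ∣
∈-subsetsOfSize [] = here refl
∈-subsetsOfSize {suc n} (true ∷ S) =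
  ∈-++⁺ʳ (map (false ∷_) (subsetsOfSize n (suc ∣ S ∣))) (∈-map⁺ (true ∷_) (∈-subsetsOfSize S))
∈-subsetsOfSize (false ∷ S) with ∣ S ∣ | ∈-subsetsOfSize S
... | zero | S∈ = ∈-map⁺ (false ∷_) S∈
... | suc _ | S∈ = ∈-++⁺ˡ (∈-map⁺ (false ∷_) S∈)

smallSubsets : ∀ n → List (Subset n)
smallSubsets n = concatMap (subsetsOfSize n) (upTo (suc (n / 3)))

length-smallSubsets : ∀ n → length (smallSubsets n) ≡ binomLeThird n
length-smallSubsets n = trans (length-concatMap (subsetsOfSize n) (upTo (suc (n / 3))))
  (cong sum (map-cong (length-subsetsOfSize n) (upTo (suc (n / 3)))))

∈-smallSubsets : ∀ {n} (S : Subset n) → Small S → S ∈ smallSubsets n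
∈-smallSubsets {n} S small = ∈-concat⁺′ (∈-subsetsOfSize S) (∈-map⁺ (subsetsOfSize n) (∈-upTo⁺ (s≤s small)))

boolLists : ℕ → List (List Bool)
boolLists m = map toList (allSubsets m)

∈-boolLists : ∀ (bs : List Bool) → bs ∈ boolLists (length bs)
∈-boolLists bs = subst (_∈ boolLists (length bs)) (toList∘fromList bs)
  (∈-map⁺ toList (allSubsets-complete (fromList bs)))

length-boolLists : ∀ m → length (boolLists m) ≡ 2 ^ m
length-boolLists m = trans (length-map toList (allSubsets m)) (length-allSubsets m)

module _ {n : ℕ} where

  dedup⊆ : ∀ {y} (xs : List (Subset n)) → y ∈ dedup xs → y ∈ xs
  dedup⊆ (x ∷ xs) (here refl) = here refl
  dedup⊆ (x ∷ xs) (there y∈) = there (dedup⊆ xs (proj₁ (∈-filter⁻ (T? ∘ (x ≠ᵇ_)) y∈)))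

  dedup-unique : ∀ (xs : List (Subset n)) → Unique (dedup xs)
  dedup-unique [] = []
  dedup-unique (x ∷ xs) =
    All.tabulate (λ y∈ → ≠ᵇ⇒≢ (proj₂ (∈-filter⁻ (T? ∘ (x ≠ᵇ_)) {xs = dedup xs} y∈)))
    ∷ Unique.filter⁺ (T? ∘ (x ≠ᵇ_)) (dedup-unique xs)

  dedup-of-unique : ∀ {xs : List (Subset n)} → Unique xs → dedup xs ≡ xs
  dedup-of-unique {[]} [] = refl
  dedup-of-unique {x ∷ xs} (x≢xs ∷ unique) = cong (x ∷_) (begin
    filterᵇ (x ≠ᵇ_) (dedup xs)  ≡⟨ cong (filterᵇ (x ≠ᵇ_)) (dedup-of-unique unique) ⟩
    filterᵇ (x ≠ᵇ_) xs          ≡⟨ filter-all (T? ∘ (x ≠ᵇ_)) (All.map ≢⇒≠ᵇ x≢xs) ⟩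
    xs                          ∎)
    where open ≡-Reasoning

-- The binary rank of a subset

fromIndex : ∀ {n} → Fin (2 ^ n) → Subset n
fromIndex {zero} _ = []
fromIndex {suc n} i with splitAt (2 ^ n) i
... | inj₁ j = false ∷ fromIndex j
... | inj₂ j with splitAt (2 ^ n) j
...   | inj₁ j′ = true ∷ fromIndex j′

fromIndex-index : ∀ {n} (S : Subset n) → fromIndex (index S) ≡ S
fromIndex-index [] = refl
fromIndex-index {suc n} (false ∷ S)
  rewrite splitAt-↑ˡ (2 ^ n) (index S) (2 ^ n + 0) = cong (false ∷_) (fromIndex-index S)
fromIndex-index {suc n} (true ∷ S)
  rewrite splitAt-↑ʳ (2 ^ n) (2 ^ n + 0) (index S ↑ˡ 0) | splitAt-↑ˡ (2 ^ n) (index S) 0 =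
  cong (true ∷_) (fromIndex-index S)

index-fromIndex : ∀ {n} (i : Fin (2 ^ n)) → index (fromIndex {n} i) ≡ i
index-fromIndex {zero} Fin.zero = refl
index-fromIndex {suc n} i with splitAt (2 ^ n) i in split₁
... | inj₁ j = trans (cong (_↑ˡ (2 ^ n + 0)) (index-fromIndex {n} j)) (splitAt⁻¹-↑ˡ split₁)
... | inj₂ j with splitAt (2 ^ n) j in split₂
...   | inj₁ j′ = trans (cong (λ k → 2 ^ n ↑ʳ (k ↑ˡ 0)) (index-fromIndex {n} j′))
                   (trans (cong (2 ^ n ↑ʳ_) (splitAt⁻¹-↑ˡ split₂)) (splitAt⁻¹-↑ʳ split₁))

rank : ∀ {n} → Subset n → ℕ
rank S = toℕ (index S)

rank-injective : ∀ {n} {S S′ : Subset n} → rank S ≡ rank S′ → S ≡ S′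
rank-injective {S = S} {S′} eq = begin
  S                      ≡⟨ fromIndex-index S ⟨
  fromIndex (index S)    ≡⟨ cong fromIndex (toℕ-injective eq) ⟩
  fromIndex (index S′)   ≡⟨ fromIndex-index S′ ⟩
  S′                     ∎
  where open ≡-Reasoning

rank-outside : ∀ {n} (S : Subset n) → rank (false ∷ S) ≡ rank S
rank-outside {n} S = toℕ-↑ˡ (index S) (2 ^ n + 0)

rank-inside : ∀ {n} (S : Subset n) → rank (true ∷ S) ≡ 2 ^ n + rank S
rank-inside {n} S = trans (toℕ-↑ʳ (2 ^ n) (index S ↑ˡ 0)) (cong (2 ^ n +_) (toℕ-↑ˡ (index S) 0))

rank-⊥ : ∀ n → rank (⊥ {n}) ≡ 0
rank-⊥ zero = refl
rank-⊥ (suc n) = trans (rank-outside (⊥ {n})) (rank-⊥ n)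

rank-∪ : ∀ {n} (X Y : Subset n) → T (disjoint X Y) → rank (X ∪ Y) ≡ rank X + rank Y
rank-∪ [] [] _ = refl
rank-∪ {suc n} (false ∷ X) (false ∷ Y) d = begin
  rank (false ∷ X ∪ Y)                 ≡⟨ rank-outside (X ∪ Y) ⟩
  rank (X ∪ Y)                         ≡⟨ rank-∪ X Y d ⟩
  rank X + rank Y                      ≡⟨ cong₂ _+_ (rank-outside X) (rank-outside Y) ⟨
  rank (false ∷ X) + rank (false ∷ Y)  ∎
  where open ≡-Reasoning
rank-∪ {suc n} (true ∷ X) (false ∷ Y) d = begin
  rank (true ∷ X ∪ Y)                 ≡⟨ rank-inside (X ∪ Y) ⟩
  2 ^ n + rank (X ∪ Y)                ≡⟨ cong (2 ^ n +_) (rank-∪ X Y d) ⟩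
  2 ^ n + (rank X + rank Y)           ≡⟨ +-assoc (2 ^ n) (rank X) (rank Y) ⟨
  2 ^ n + rank X + rank Y             ≡⟨ cong₂ _+_ (rank-inside X) (rank-outside Y) ⟨
  rank (true ∷ X) + rank (false ∷ Y)  ∎
  where open ≡-Reasoning
rank-∪ {suc n} (false ∷ X) (true ∷ Y) d = begin
  rank (true ∷ X ∪ Y)                 ≡⟨ rank-inside (X ∪ Y) ⟩
  2 ^ n + rank (X ∪ Y)                ≡⟨ cong (2 ^ n +_) (rank-∪ X Y d) ⟩
  2 ^ n + (rank X + rank Y)           ≡⟨ x∙yz≈y∙xz (2 ^ n) (rank X) (rank Y) ⟩
  rank X + (2 ^ n + rank Y)           ≡⟨ cong₂ _+_ (rank-outside X) (rank-inside Y) ⟨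
  rank (false ∷ X) + rank (true ∷ Y)  ∎
  where open ≡-Reasoning

rank<rank-∪ : ∀ {n} (X Y : Subset n) → T (disjoint X Y) → Y ≢ ⊥ → rank X < rank (X ∪ Y)
rank<rank-∪ {n} X Y d Y≢⊥ = subst (rank X <_) (sym (rank-∪ X Y d))
  (m<m+n (rank X) (n≢0⇒n>0 (λ rankY≡0 → Y≢⊥ (rank-injective (trans rankY≡0 (sym (rank-⊥ n)))))))

module _ {n : ℕ} where

  allPairs-elim : ∀ (p : Subset n → Subset n → Bool) →
    T (all (λ X → all (p X) (allSubsets n)) (allSubsets n)) → ∀ X Y → T (p X Y)
  allPairs-elim p holds X Y = All.lookup
    (all⁺ (p X) _ (All.lookup (all⁺ (λ X → all (p X) (allSubsets n)) _ holds) (allSubsets-complete X)))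
    (allSubsets-complete Y)

  allPairs-intro : ∀ (p : Subset n → Subset n → Bool) →
    (∀ X Y → T (p X Y)) → T (all (λ X → all (p X) (allSubsets n)) (allSubsets n))
  allPairs-intro p holds = all⁻ (λ X → all (p X) (allSubsets n)) {allSubsets n}
    (All.universal (λ X → all⁻ (p X) {allSubsets n} (All.universal (holds X) _)) _)

  singletonEmpty⇒⊥∈ : ∀ {B : Collection n} → T (isSingletonEmpty B) → T (B ⊥)
  singletonEmpty⇒⊥∈ {B} singleton = T-not-xor-elim
    (All.lookup (all⁺ (λ S → not (B S xor (S == ⊥))) _ singleton) (allSubsets-complete ⊥))
    (==-refl (⊥ {n}))

  hits-cong : ∀ {B B′ : Collection n} → B ≗ B′ → ∀ X Y → hits B X Y ≡ hits B′ X Y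
  hits-cong {B} {B′} B≗B′ X Y = cong length (filter-≐ (T? ∘ B) (T? ∘ B′)
    ((λ {S} → subst T (B≗B′ S)) , (λ {S} → subst T (sym (B≗B′ S)))) (dedup (X ∷ Y ∷ X ∪ Y ∷ [])))

  hits-nonempty : ∀ (B : Collection n) X Y → T (disjoint X Y) → X ≢ ⊥ → Y ≢ ⊥ →
    hits B X Y ≡ length (filterᵇ B (X ∷ Y ∷ X ∪ Y ∷ []))
  hits-nonempty B X Y d X≢⊥ Y≢⊥ =
    cong (length ∘ filterᵇ B) (dedup-of-unique ((X≢Y ∷ X≢X∪Y ∷ []) ∷ (Y≢X∪Y ∷ []) ∷ [] ∷ []))
    where
    X≢Y : X ≢ Y
    X≢Y refl = X≢⊥ (disjoint-self⇒⊥ X d)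
    X≢X∪Y : X ≢ X ∪ Y
    X≢X∪Y X≡X∪Y = <-irrefl (cong rank X≡X∪Y) (rank<rank-∪ X Y d Y≢⊥)
    Y≢X∪Y : Y ≢ X ∪ Y
    Y≢X∪Y Y≡X∪Y = <-irrefl (cong rank (trans Y≡X∪Y (∪-comm X Y))) (rank<rank-∪ Y X (disjoint-sym X Y d) X≢⊥)

  module _ {B : Collection n} (linear : T (isLinear B)) where

    private
      B? = T? ∘ B

    linear⇒hits≢2 : ∀ X Y → T (disjoint X Y) → hits B X Y ≢ 2
    linear⇒hits≢2 X Y d hits≡2 =
      T-not⇒¬T (T-not-∨-elim (allPairs-elim _ (proj₂ (Equivalence.to T-∧ linear)) X Y) d)
        (subst (λ h → T (h ≡ᵇ 2)) (sym hits≡2) _)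

    linear-∪-closed : ∀ X Y → T (disjoint X Y) → X ≢ ⊥ → Y ≢ ⊥ → T (B X) → T (B Y) → T (B (X ∪ Y))
    linear-∪-closed X Y d X≢⊥ Y≢⊥ bX bY = decidable-stable (B? (X ∪ Y)) λ ¬bU →
      linear⇒hits≢2 X Y d (trans (hits-nonempty B X Y d X≢⊥ Y≢⊥) (cong length
        (trans (filter-accept B? bX) (cong (X ∷_)
          (trans (filter-accept B? bY) (cong (Y ∷_) (filter-reject B? ¬bU)))))))

    linear-∪-cancelˡ : ∀ X Y → T (disjoint X Y) → X ≢ ⊥ → Y ≢ ⊥ → T (B X) → T (B (X ∪ Y)) → T (B Y)
    linear-∪-cancelˡ X Y d X≢⊥ Y≢⊥ bX bU = decidable-stable (B? Y) λ ¬bY →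
      linear⇒hits≢2 X Y d (trans (hits-nonempty B X Y d X≢⊥ Y≢⊥) (cong length
        (trans (filter-accept B? bX) (cong (X ∷_) (trans (filter-reject B? ¬bY) (filter-accept B? bU))))))

  filterᵇ-dedup-length≤1 : ∀ (B : Collection n) (xs : List (Subset n)) →
    (∀ {U V} → U ∈ xs → V ∈ xs → T (B U) → T (B V) → U ≡ V) → length (filterᵇ B (dedup xs)) ≤ 1
  filterᵇ-dedup-length≤1 B xs at-most-one =
    Unique⇒length≤1 (Unique.filter⁺ (T? ∘ B) (dedup-unique xs)) λ U∈ V∈ →
      let U∈xs , bU = ∈-filter⁻ (T? ∘ B) {xs = dedup xs} U∈
          V∈xs , bV = ∈-filter⁻ (T? ∘ B) {xs = dedup xs} V∈
      in at-most-one (dedup⊆ xs U∈xs) (dedup⊆ xs V∈xs) bU bV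

  scarce-intro : ∀ {B : Collection n} → ¬ T (B ⊥) → (∀ X Y → T (disjoint X Y) → hits B X Y ≤ 1) →
    T (isScarce B)
  scarce-intro {B} ⊥∉B hits≤1 = Equivalence.from T-∧
    ( Equivalence.from T-∧ (¬T⇒T-not (⊥∉B ∘ singletonEmpty⇒⊥∈ {B}) , allPairs-intro _ λ X Y →
        T-not-∨-intro λ d → ¬T⇒T-not λ hits≡ᵇ2 → <⇒≢ (s≤s (hits≤1 X Y d)) (≡ᵇ⇒≡ (hits B X Y) 2 hits≡ᵇ2))
    , allPairs-intro _ λ X Y → T-not-∨-intro λ d → ≤⇒≤ᵇ (hits≤1 X Y d))

-- The core of a collection

module _ {n : ℕ} where

  Splits : Collection n → Subset n → Set
  Splits B S = ∃[ Y ] ∃[ Z ] T (B Y) × Y ≢ ⊥ × Z ≢ ⊥ × T (disjoint Y Z) × Y ∪ Z ≡ S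

  Dominated : Collection n → Subset n → Set
  Dominated B S = ∃[ Y ] T (B Y) × Large Y × T (disjoint S Y) × rank Y < rank S

  InCore : Collection n → Subset n → Set
  InCore B S = T (B S) × Large S × ¬ Splits B S × ¬ Dominated B S

  private
    _≟ₛ_ : DecidableEquality (Subset n)
    _≟ₛ_ = ≡-dec Bool._≟_

  splits? : ∀ B → Decidable (Splits B)
  splits? B S = anySubset? λ Y → anySubset? λ Z →
    T? (B Y) ×-dec ¬? (Y ≟ₛ ⊥) ×-dec ¬? (Z ≟ₛ ⊥) ×-dec T? (disjoint Y Z) ×-dec (Y ∪ Z) ≟ₛ S

  dominated? : ∀ B → Decidable (Dominated B)
  dominated? B S = anySubset? λ Y →
    T? (B Y) ×-dec n / 3 <? ∣ Y ∣ ×-dec T? (disjoint S Y) ×-dec rank Y <? rank S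

  inCore? : ∀ B → Decidable (InCore B)
  inCore? B S = T? (B S) ×-dec n / 3 <? ∣ S ∣ ×-dec ¬? (splits? B S) ×-dec ¬? (dominated? B S)

  core : Collection n → Collection n
  core B S = ⌊ inCore? B S ⌋

  module _ {B : Collection n} where

    inCore-disjoint : ∀ {X Y} → T (disjoint X Y) → InCore B X → InCore B Y → X ≡ Y
    inCore-disjoint {X} {Y} d (bX , largeX , _ , ¬dominatedX) (bY , largeY , _ , ¬dominatedY)
      with <-cmp (rank X) (rank Y)
    ... | tri< X≺Y _ _ = ⊥-elim (¬dominatedY (X , bX , largeX , disjoint-sym X Y d , X≺Y))
    ... | tri≈ _ same _ = rank-injective same
    ... | tri> _ _ Y≺X = ⊥-elim (¬dominatedX (Y , bY , largeY , d , Y≺X))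

    inCore-∪ : ∀ {X Y} → T (disjoint X Y) → InCore B X → InCore B (X ∪ Y) → X ≡ X ∪ Y
    inCore-∪ {X} {Y} d (bX , largeX , _ , _) (_ , _ , ¬splits , _) with Y ≟ₛ ⊥
    ... | yes refl = sym (∪-identityʳ X)
    ... | no Y≢⊥ = ⊥-elim (¬splits (X , Y , bX , large⇒≢⊥ largeX , Y≢⊥ , d , refl))

    core-hits≤1 : ∀ X Y → T (disjoint X Y) → hits (core B) X Y ≤ 1
    core-hits≤1 X Y d = filterᵇ-dedup-length≤1 (core B) _ λ U∈ V∈ U∈core V∈core →
      same U∈ V∈ (toWitness U∈core) (toWitness V∈core)
      where
      d′ = disjoint-sym X Y d
      X∪Y≡Y∪X = ∪-comm X Y
      Y≡X∪Y : InCore B Y → InCore B (X ∪ Y) → Y ≡ X ∪ Y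
      Y≡X∪Y cY cU = trans (inCore-∪ d′ cY (subst (InCore B) X∪Y≡Y∪X cU)) (sym X∪Y≡Y∪X)
      same : ∀ {U V} → U ∈ (X ∷ Y ∷ X ∪ Y ∷ []) → V ∈ (X ∷ Y ∷ X ∪ Y ∷ []) → InCore B U → InCore B V → U ≡ V
      same (here refl) (here refl) _ _ = refl
      same (here refl) (there (here refl)) cX cY = inCore-disjoint d cX cY
      same (here refl) (there (there (here refl))) cX cU = inCore-∪ d cX cU
      same (there (here refl)) (here refl) cY cX = inCore-disjoint d′ cY cX
      same (there (here refl)) (there (here refl)) _ _ = refl
      same (there (here refl)) (there (there (here refl))) cY cU = Y≡X∪Y cY cU
      same (there (there (here refl))) (here refl) cU cX = sym (inCore-∪ d cX cU)
      same (there (there (here refl))) (there (here refl)) cU cY = sym (Y≡X∪Y cY cU)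
      same (there (there (here refl))) (there (there (here refl))) _ _ = refl

    ⊥∉core : ¬ T (core B ⊥)
    ⊥∉core ⊥∈core = large⇒≢⊥ {n} (proj₁ (proj₂ (toWitness ⊥∈core))) refl

  -- Stated up to ≗: the enumerated collections are lookup tables, equal to core B only pointwise.
  core-scarce : ∀ {B B′ : Collection n} → B′ ≗ core B → T (isScarce B′)
  core-scarce {B} {B′} B′≗core = scarce-intro {B = B′}
    (⊥∉core {B} ∘ subst T (B′≗core ⊥))
    (λ X Y d → subst (_≤ 1) (sym (hits-cong B′≗core X Y)) (core-hits≤1 {B} X Y d))

-- Reconstruction of a linear collection

module _ {n : ℕ} {B B′ : Collection n}
  (linear : T (isLinear B)) (linear′ : T (isLinear B′)) (same-core : core B ≗ core B′)
  (same-small : ∀ S → Small S → B S ≡ B′ S) (same-cosmall : ∀ S → Small (∁ S) → B S ≡ B′ S)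
  where

  membership-transfer : ∀ S → (∀ Y → rank Y < rank S → B Y ≡ B′ Y) → T (B S) → T (B′ S)
  membership-transfer S below bS with n / 3 <? ∣ S ∣
  ... | no ¬largeS = subst T (same-small S (≮⇒≥ ¬largeS)) bS
  ... | yes largeS with splits? B S
  ...   | yes (Y , Z , bY , Y≢⊥ , Z≢⊥ , d , refl) =
    linear-∪-closed linear′ Y Z d Y≢⊥ Z≢⊥ (subst T (below Y Y≺S) bY) (subst T (below Z Z≺S) bZ)
    where
    bZ : T (B Z)
    bZ = linear-∪-cancelˡ linear Y Z d Y≢⊥ Z≢⊥ bY bS
    Y≺S : rank Y < rank (Y ∪ Z)
    Y≺S = rank<rank-∪ Y Z d Z≢⊥
    Z≺S : rank Z < rank (Y ∪ Z)
    Z≺S = subst (rank Z <_) (cong rank (∪-comm Z Y)) (rank<rank-∪ Z Y (disjoint-sym Y Z d) Y≢⊥)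
  ...   | no ¬splits with dominated? B S
  ...     | yes (Y , bY , largeY , d , Y≺S) =
    linear-∪-cancelˡ linear′ Y S (disjoint-sym S Y d) Y≢⊥ S≢⊥ (subst T (below Y Y≺S) bY) b′Y∪S
    where
    S≢⊥ : S ≢ ⊥
    S≢⊥ = large⇒≢⊥ largeS
    Y≢⊥ : Y ≢ ⊥
    Y≢⊥ = large⇒≢⊥ largeY
    bS∪Y : T (B (S ∪ Y))
    bS∪Y = linear-∪-closed linear S Y d S≢⊥ Y≢⊥ bS bY
    b′Y∪S : T (B′ (Y ∪ S))
    b′Y∪S = subst (T ∘ B′) (∪-comm S Y)
      (subst T (same-cosmall (S ∪ Y) (large-∪-cosmall S Y d largeS largeY)) bS∪Y)
  ...     | no ¬dominated =
    proj₁ (toWitness (subst T (same-core S) (fromWitness (bS , largeS , ¬splits , ¬dominated))))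

linear-determined : ∀ {n} {B B′ : Collection n} → T (isLinear B) → T (isLinear B′) → core B ≗ core B′ →
  (∀ S → Small S → B S ≡ B′ S) → (∀ S → Small (∁ S) → B S ≡ B′ S) → B ≗ B′
linear-determined {B = B} {B′} linear linear′ same-core same-small same-cosmall S =
  agree (On.wellFounded rank <-wellFounded S)
  where
  agree : ∀ {S} → Acc (_<_ on rank) S → B S ≡ B′ S
  agree {S} (acc below) = T-⇔⇒≡
    (membership-transfer linear linear′ same-core same-small same-cosmall S agree-below)
    (membership-transfer linear′ linear (sym ∘ same-core) (λ S → sym ∘ same-small S)
      (λ S → sym ∘ same-cosmall S) S (λ Y → sym ∘ agree-below Y))
    where
    agree-below : ∀ Y → rank Y < rank S → B Y ≡ B′ Y
    agree-below Y Y≺S = agree (below Y≺S)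

-- Counting

module _ (n : ℕ) where

  decode : Vec Bool (2 ^ n) → Collection n
  decode v S = lookup v (index S)

  encode : Collection n → Vec Bool (2 ^ n)
  encode B = tabulate (B ∘ fromIndex)

  decode-encode : ∀ B → decode (encode B) ≗ B
  decode-encode B S = trans (lookup∘tabulate (B ∘ fromIndex) (index S)) (cong B (fromIndex-index S))

  decode-injective : ∀ {v w} → decode v ≗ decode w → v ≡ w
  decode-injective {v} {w} same = begin
    v                    ≡⟨ tabulate∘lookup v ⟨
    tabulate (lookup v)  ≡⟨ tabulate-cong same-entries ⟩
    tabulate (lookup w)  ≡⟨ tabulate∘lookup w ⟩
    w                    ∎
    where
    open ≡-Reasoning
    same-entries : ∀ i → lookup v i ≡ lookup w i
    same-entries i = subst (λ j → lookup v j ≡ lookup w j) (index-fromIndex {n} i) (same (fromIndex i))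

  codesSatisfying : (Collection n → Bool) → List (Vec Bool (2 ^ n))
  codesSatisfying p = filterᵇ (p ∘ decode) (allSubsets (2 ^ n))

  length-codesSatisfying : ∀ p → length (filterᵇ p (allCollections n)) ≡ length (codesSatisfying p)
  length-codesSatisfying p = trans (cong length (filterᵇ-map p decode (allSubsets (2 ^ n))))
    (length-map decode (codesSatisfying p))

  codesSatisfying-unique : ∀ p → Unique (codesSatisfying p)
  codesSatisfying-unique p = Unique.filter⁺ (T? ∘ p ∘ decode) (allSubsets-unique (2 ^ n))

  Fingerprint : Set
  Fingerprint = Vec Bool (2 ^ n) × List Bool × List Bool

  fingerprint : Vec Bool (2 ^ n) → Fingerprint
  fingerprint v = encode (core B) , map B (smallSubsets n) , map (B ∘ ∁) (smallSubsets n)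
    where B = decode v

  fingerprints : List Fingerprint
  fingerprints = cartesianProduct (codesSatisfying isScarce)
    (cartesianProduct (boolLists (binomLeThird n)) (boolLists (binomLeThird n)))

  fingerprint∈fingerprints : ∀ v → fingerprint v ∈ fingerprints
  fingerprint∈fingerprints v = ∈-cartesianProduct⁺ core-code∈
    (∈-cartesianProduct⁺ (restriction∈ (decode v)) (restriction∈ (decode v ∘ ∁)))
    where
    core-code∈ : encode (core (decode v)) ∈ codesSatisfying isScarce
    core-code∈ = ∈-filter⁺ (T? ∘ isScarce ∘ decode) (allSubsets-complete _)
      (core-scarce (decode-encode (core (decode v))))
    restriction∈ : ∀ (B : Collection n) → map B (smallSubsets n) ∈ boolLists (binomLeThird n)
    restriction∈ B = subst (λ m → map B (smallSubsets n) ∈ boolLists m)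
      (trans (length-map B (smallSubsets n)) (length-smallSubsets n)) (∈-boolLists _)

  fingerprint-injective : ∀ {v w} → v ∈ codesSatisfying isLinear → w ∈ codesSatisfying isLinear →
    fingerprint v ≡ fingerprint w → v ≡ w
  fingerprint-injective {v} {w} v∈ w∈ same = decode-injective (linear-determined
    (proj₂ (∈-filter⁻ (T? ∘ isLinear ∘ decode) {xs = allSubsets (2 ^ n)} v∈))
    (proj₂ (∈-filter⁻ (T? ∘ isLinear ∘ decode) {xs = allSubsets (2 ^ n)} w∈))
    same-core same-small same-cosmall)
    where
    same-core : core (decode v) ≗ core (decode w)
    same-core S = begin
      core (decode v) S                      ≡⟨ decode-encode (core (decode v)) S ⟨
      decode (encode (core (decode v))) S    ≡⟨ cong (λ c → decode c S) (cong proj₁ same) ⟩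
      decode (encode (core (decode w))) S    ≡⟨ decode-encode (core (decode w)) S ⟩
      core (decode w) S                      ∎
      where open ≡-Reasoning
    same-small : ∀ S → Small S → decode v S ≡ decode w S
    same-small S small = map-≡⇒≗-on (smallSubsets n) (cong (proj₁ ∘ proj₂) same) (∈-smallSubsets S small)
    same-cosmall : ∀ S → Small (∁ S) → decode v S ≡ decode w S
    same-cosmall S cosmall = subst (λ U → decode v U ≡ decode w U) (∁-involutive S)
      (map-≡⇒≗-on (smallSubsets n) (cong (proj₂ ∘ proj₂) same) (∈-smallSubsets (∁ S) cosmall))

  length-fingerprints : length fingerprints ≡ numScarce n * 2 ^ (2 * binomLeThird n)
  length-fingerprints = begin
    length fingerprints
      ≡⟨ length-cartesianProduct (codesSatisfying isScarce) (cartesianProduct codes codes) ⟩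
    length (codesSatisfying isScarce) * length (cartesianProduct codes codes)
      ≡⟨ cong₂ _*_ (length-codesSatisfying isScarce) (sym (length-cartesianProduct codes codes)) ⟨
    numScarce n * (length codes * length codes)
      ≡⟨ cong (λ m → numScarce n * (m * m)) (length-boolLists b) ⟩
    numScarce n * (2 ^ b * 2 ^ b)
      ≡⟨ cong (numScarce n *_) (^-distribˡ-+-* 2 b b) ⟨
    numScarce n * 2 ^ (b + b)
      ≡⟨ cong (λ m → numScarce n * 2 ^ (b + m)) (+-identityʳ b) ⟨
    numScarce n * 2 ^ (2 * b)  ∎
    where
    open ≡-Reasoning
    b = binomLeThird n
    codes = boolLists b

-- The bound also holds for n = 0.
lemma3p5 : (n : ℕ) → 1 ≤ n → numLinear n ≤ numScarce n * 2 ^ (2 * binomLeThird n)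
lemma3p5 n _ = begin
  numLinear n
    ≡⟨ length-codesSatisfying n isLinear ⟩
  length (codesSatisfying n isLinear)
    ≤⟨ length-≤-injectiveOn (fingerprint n) (codesSatisfying-unique n isLinear)
         (λ {v} _ → fingerprint∈fingerprints n v) (fingerprint-injective n) ⟩
  length (fingerprints n)
    ≡⟨ length-fingerprints n ⟩
  numScarce n * 2 ^ (2 * binomLeThird n)  ∎
  where open ≤-Reasoning
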